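{- The set-function $\mathrm{Max}$ is not $(\oplus,\Downarrow,\mathcal{P})$-definable.
   Context: $\mathbb{N}=\{0,1,2,\ldots\}$, $2^{\mathbb{N}}$ is its power set. A set-function is a map $(2^{\mathbb{N}})^k\to2^{\mathbb{N}}$ for some $k\ge0$. For a collection $\mathcal{O}$ of set-functions, $\mathcal{O}$-circuits are terms built from variables ranging over $2^{\mathbb{N}}$, the constants $\emptyset$, $\mathbb{N}$, $\{n\}$ ($n\in\mathbb{N}$), the operations $\cup$, $\cap$, complement relative to $\mathbb{N}$, and the functions in $\mathcal{O}$; a set-function is $\mathcal{O}$-definable if some $\mathcal{O}$-circuit evaluates to it. $(\oplus,\Downarrow,\mathcal{P})$-definable means $(\{\oplus,\Downarrow\}\cup\mathcal{P})$-definable, where $s\oplus t=\{m+n\mid m\in s,n\in t\}$, $\Downarrow(x)=\{m\in\mathbb{N}\mid\exists n\in x,\ m\le n\}$, and $\mathcal{P}$ is the collection of all set-functions (all arities) whose values all lie in $\{\emptyset,\{0\}\}$. $\mathrm{Max}(x)=\emptyset$ if $x=\emptyset$, $\mathbb{N}$ if $x$ is infinite, $\{\max x\}$ otherwise. -}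

module Defs where

open import Data.Nat using (ℕ; _+_; _≤_)
open import Data.Fin using (Fin)
open import Data.Product using (Σ; _×_; ∃)
open import Data.Sum using (_⊎_)
open import Data.Empty using (⊥)
open import Data.Unit using (⊤)
open import Relation.Nullary using (¬_)
open import Relation.Binary.PropositionalEquality using (_≡_)

SetN : Set₁
SetN = ℕ → Set

infix 4 _≈_
_≈_ : SetN → SetN → Set
s ≈ t = ∀ n → (s n → t n) × (t n → s n)

∅ : SetN
∅ _ = ⊥

ℕˢ : SetN
ℕˢ _ = ⊤

⟨_⟩ : ℕ → SetN
⟨ m ⟩ n = n ≡ m

_∪ˢ_ : SetN → SetN → SetN
(s ∪ˢ t) n = s n ⊎ t n

_∩ˢ_ : SetN → SetN → SetN
(s ∩ˢ t) n = s n × t n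

∁ : SetN → SetN
∁ s n = ¬ s n

_⊕_ : SetN → SetN → SetN
(s ⊕ t) k = Σ ℕ λ m → Σ ℕ λ n → (m + n ≡ k) × s m × t n

⇓ : SetN → SetN
⇓ x m = Σ ℕ λ n → (m ≤ n) × x n

SetFun : ℕ → Set₁
SetFun k = (Fin k → SetN) → SetN

-- A set-function respects equality of sets (automatic for set-functions
-- on the genuine power set; needed here since sets are predicates).
Extensional : ∀ {k} → SetFun k → Set₁
Extensional {k} f = (xs ys : Fin k → SetN) → (∀ i → xs i ≈ ys i) → f xs ≈ f ys

InP : ∀ {k} → SetFun k → Set₁
InP {k} f = Extensional f × ((xs : Fin k → SetN) → (f xs ≈ ∅) ⊎ (f xs ≈ ⟨ 0 ⟩))

data Circ (k : ℕ) : Set₁ where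
  var    : Fin k → Circ k
  cempty : Circ k
  cfull  : Circ k
  csing  : ℕ → Circ k
  cunion : Circ k → Circ k → Circ k
  cinter : Circ k → Circ k → Circ k
  ccompl : Circ k → Circ k
  cplus  : Circ k → Circ k → Circ k
  cdown  : Circ k → Circ k
  cP     : (m : ℕ) (f : SetFun m) → InP f → (Fin m → Circ k) → Circ k

⟦_⟧ : ∀ {k} → Circ k → SetFun k
⟦ var i ⟧ ρ = ρ i
⟦ cempty ⟧ ρ = ∅
⟦ cfull ⟧ ρ = ℕˢ
⟦ csing m ⟧ ρ = ⟨ m ⟩
⟦ cunion c d ⟧ ρ = ⟦ c ⟧ ρ ∪ˢ ⟦ d ⟧ ρ
⟦ cinter c d ⟧ ρ = ⟦ c ⟧ ρ ∩ˢ ⟦ d ⟧ ρ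
⟦ ccompl c ⟧ ρ = ∁ (⟦ c ⟧ ρ)
⟦ cplus c d ⟧ ρ = ⟦ c ⟧ ρ ⊕ ⟦ d ⟧ ρ
⟦ cdown c ⟧ ρ = ⇓ (⟦ c ⟧ ρ)
⟦ cP m f _ cs ⟧ ρ = f (λ i → ⟦ cs i ⟧ ρ)

Definable : ∀ {k} → SetFun k → Set₁
Definable {k} F = Σ (Circ k) λ C → (ρ : Fin k → SetN) → ⟦ C ⟧ ρ ≈ F ρ

-- x is infinite (= unbounded, for subsets of ℕ).
Infinite : SetN → Set
Infinite x = ∀ k → Σ ℕ λ m → (k ≤ m) × x m

-- Max(x) = ∅ if x = ∅, ℕ if x infinite, {max x} otherwise.
-- n ∈ Max(x)  iff  x is infinite, or n ∈ x and n is the largest element of x.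
Max : SetN → SetN
Max x n = Infinite x ⊎ (x n × (∀ m → x m → m ≤ n))

MaxFun : SetFun 1
MaxFun ρ = Max (ρ Fin.zero)

-- Fix a modulus n and a width D.  Call x a jump point if x ∈ [b·n, b·n + D)
-- for some b, and call a set S steady (for n, D) if membership in S can only
-- change between x and x + 1 when x is a jump point.  Sets are predicates
-- here, so "does not change" is read up to double negation; this lets us
-- case-split on the (classically decidable) jump condition.
--
-- Steadiness is preserved by all circuit operations, at the cost of enlarging
-- the width: Boolean operations and ⇓ keep D, ⊕ adds the widths (a jump point
-- of width D₁ plus one of width D₂ is a jump point of width D₁ + D₂), and all
-- sets bounded by c, in particular every value of a 𝒫-function, are steady of
-- width c + 1.  Hence every circuit C comes with a width D, independent of n,
-- such that C sends steady inputs to steady outputs.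
--
-- The interval [0, n] is steady of width 1 for every n, while
-- Max [0, n] = {n} changes between n - 1 and n.  Taking n = D + 1 makes
-- n - 1 = D a non-jump point, so no circuit computes Max.
module Submission where

open import Defs
open import Relation.Nullary using (¬_; yes; no; ¬¬-excluded-middle)
open import Relation.Nullary.Negation using (¬¬-Monad; ¬¬-map)
open import Effect.Monad using (RawMonad)
open import Level using (0ℓ)
open import Data.Nat using (ℕ; zero; suc; _+_; _*_; _≤_; _<_; _≤?_; z≤n; s≤s)
open import Data.Nat.Properties
open import Algebra.Properties.CommutativeSemigroup +-commutativeSemigroup using (interchange)
open import Data.Fin using (Fin)
open import Data.Product using (Σ; _×_; _,_; proj₁; proj₂)
open import Data.Sum using (_⊎_; inj₁; inj₂)
open import Data.Empty using (⊥-elim)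
open import Data.Unit using (tt)
open import Relation.Binary.PropositionalEquality
  using (refl; sym; trans; cong; subst)

open RawMonad (¬¬-Monad {0ℓ}) using (pure; _>>=_)

JumpAt : ℕ → ℕ → ℕ → Set
JumpAt n D x = Σ ℕ λ b → (b * n ≤ x) × (x < b * n + D)

jump-mono : ∀ {n D D' x} → D ≤ D' → JumpAt n D x → JumpAt n D' x
jump-mono {n} le (b , lower , upper) = b , lower , ≤-trans upper (+-monoʳ-≤ (b * n) le)

jump-+ : ∀ {n D₁ D₂ x y z} → JumpAt n D₁ x → JumpAt n D₂ y →
         x + y ≤ z → z ≤ suc (x + y) → JumpAt n (D₁ + D₂) z
jump-+ {n} {D₁} {D₂} {x} {y} {z} (b₁ , lower₁ , upper₁) (b₂ , lower₂ , upper₂) x+y≤z z≤x+y+1 =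
  b₁ + b₂ , lower , upper
  where
  lower : (b₁ + b₂) * n ≤ z
  lower = ≤-trans (≤-reflexive (*-distribʳ-+ n b₁ b₂)) (≤-trans (+-mono-≤ lower₁ lower₂) x+y≤z)
  upper : suc z ≤ (b₁ + b₂) * n + (D₁ + D₂)
  upper = begin
    suc z                               ≤⟨ s≤s z≤x+y+1 ⟩
    suc (suc (x + y))                   ≡⟨ cong suc (sym (+-suc x y)) ⟩
    suc x + suc y                       ≤⟨ +-mono-≤ upper₁ upper₂ ⟩
    (b₁ * n + D₁) + (b₂ * n + D₂)       ≡⟨ interchange (b₁ * n) D₁ (b₂ * n) D₂ ⟩
    (b₁ * n + b₂ * n) + (D₁ + D₂)       ≡⟨ cong (_+ (D₁ + D₂)) (sym (*-distribʳ-+ n b₁ b₂)) ⟩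
    (b₁ + b₂) * n + (D₁ + D₂)           ∎
    where open ≤-Reasoning

-- For modulus D + 1, the point D lies strictly between the windows [0, D) and [D + 1, 2D + 1).
no-jump : ∀ D → ¬ JumpAt (suc D) D D
no-jump D (zero , _ , D<D) = <-irrefl refl D<D
no-jump D (suc b , D+1+b·n≤D , _) = 1+n≰n (m+n≤o⇒m≤o (suc D) D+1+b·n≤D)

Steady : ℕ → ℕ → SetN → Set
Steady n D S = ∀ k → ¬ JumpAt n D k → (S k → ¬ ¬ S (suc k)) × (S (suc k) → ¬ ¬ S k)

step-up : ∀ {n D S k} → Steady n D S → S k → ¬ ¬ (S (suc k) ⊎ JumpAt n D k)
step-up {k = k} steady s = ¬¬-excluded-middle >>= λ where
  (yes jump) → pure (inj₂ jump)
  (no ¬jump) → ¬¬-map inj₁ (proj₁ (steady k ¬jump) s)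

step-down : ∀ {n D S k} → Steady n D S → S (suc k) → ¬ ¬ (S k ⊎ JumpAt n D k)
step-down {k = k} steady s = ¬¬-excluded-middle >>= λ where
  (yes jump) → pure (inj₂ jump)
  (no ¬jump) → ¬¬-map inj₁ (proj₂ (steady k ¬jump) s)

steady-mono : ∀ {n D D' S} → D ≤ D' → Steady n D S → Steady n D' S
steady-mono le steady k ¬jump = steady k (λ jump → ¬jump (jump-mono le jump))

steady-resp : ∀ {n D S T} → S ≈ T → Steady n D S → Steady n D T
steady-resp S≈T steady k ¬jump =
  (λ t → ¬¬-map (proj₁ (S≈T (suc k))) (proj₁ (steady k ¬jump) (proj₂ (S≈T k) t))) ,
  (λ t → ¬¬-map (proj₁ (S≈T k)) (proj₂ (steady k ¬jump) (proj₂ (S≈T (suc k)) t)))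

-- A set bounded by c is steady of width c + 1: below c every point is a jump.
bounded-steady : ∀ {n S} c → (∀ k → S k → k ≤ c) → Steady n (suc c) S
bounded-steady c bounded k ¬jump with k ≤? c
... | yes k≤c = ⊥-elim (¬jump (0 , z≤n , s≤s k≤c))
... | no k≰c = (λ s → ⊥-elim (k≰c (bounded k s))) ,
               (λ s → ⊥-elim (k≰c (≤-trans (n≤1+n k) (bounded (suc k) s))))

full-steady : ∀ {n D} → Steady n D ℕˢ
full-steady k _ = (λ _ ¬t → ¬t tt) , (λ _ ¬t → ¬t tt)

union-steady : ∀ {n D S T} → Steady n D S → Steady n D T → Steady n D (S ∪ˢ T)
union-steady steadyS steadyT k ¬jump =
  (λ { (inj₁ s) → ¬¬-map inj₁ (proj₁ (steadyS k ¬jump) s)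
     ; (inj₂ t) → ¬¬-map inj₂ (proj₁ (steadyT k ¬jump) t) }) ,
  (λ { (inj₁ s) → ¬¬-map inj₁ (proj₂ (steadyS k ¬jump) s)
     ; (inj₂ t) → ¬¬-map inj₂ (proj₂ (steadyT k ¬jump) t) })

inter-steady : ∀ {n D S T} → Steady n D S → Steady n D T → Steady n D (S ∩ˢ T)
inter-steady steadyS steadyT k ¬jump =
  (λ { (s , t) → both (proj₁ (steadyS k ¬jump) s) (proj₁ (steadyT k ¬jump) t) }) ,
  (λ { (s , t) → both (proj₂ (steadyS k ¬jump) s) (proj₂ (steadyT k ¬jump) t) })
  where
  both : ∀ {P Q : Set} → ¬ ¬ P → ¬ ¬ Q → ¬ ¬ (P × Q)
  both ¬¬p ¬¬q = ¬¬p >>= λ p → ¬¬q >>= λ q → pure (p , q)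

compl-steady : ∀ {n D S} → Steady n D S → Steady n D (∁ S)
compl-steady steady k ¬jump =
  (λ ¬s ¬¬s' → ¬¬s' (λ s' → proj₂ (steady k ¬jump) s' ¬s)) ,
  (λ ¬s' ¬¬s → ¬¬s (λ s → proj₁ (steady k ¬jump) s ¬s'))

-- ⇓ S only gains k + 1 over k when k itself is the witness, i.e. when S does.
down-steady : ∀ {n D S} → Steady n D S → Steady n D (⇓ S)
down-steady {S = S} steady k ¬jump = up , down
  where
  up : ⇓ S k → ¬ ¬ ⇓ S (suc k)
  up (m , k≤m , s) with m≤n⇒m<n∨m≡n k≤m
  ... | inj₁ k<m = pure (m , k<m , s)
  ... | inj₂ refl = ¬¬-map (λ s' → suc k , ≤-refl , s') (proj₁ (steady k ¬jump) s)
  down : ⇓ S (suc k) → ¬ ¬ ⇓ S k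
  down (m , k+1≤m , s) = pure (m , ≤-trans (n≤1+n k) k+1≤m , s)

-- Moving a sum i + j up by one: move i or j up, unless both are jump points.
plus-up : ∀ {n D₁ D₂ S T k} → Steady n D₁ S → Steady n D₂ T →
          ¬ JumpAt n (D₁ + D₂) k → (S ⊕ T) k → ¬ ¬ (S ⊕ T) (suc k)
plus-up steadyS steadyT ¬jump (i , j , refl , s , t) = step-up steadyS s >>= λ where
  (inj₁ s') → pure (suc i , j , refl , s' , t)
  (inj₂ jumpᵢ) → step-up steadyT t >>= λ where
    (inj₁ t') → pure (i , suc j , +-suc i j , s , t')
    (inj₂ jumpⱼ) → ⊥-elim (¬jump (jump-+ jumpᵢ jumpⱼ ≤-refl (n≤1+n _)))

-- Moving a sum down by one: move a positive summand down, unless it is blocked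
-- by a jump point, in which case the sum itself was a jump point.
plus-down : ∀ {n D₁ D₂ S T k} → Steady n D₁ S → Steady n D₂ T →
            ¬ JumpAt n (D₁ + D₂) k → (S ⊕ T) (suc k) → ¬ ¬ (S ⊕ T) k
plus-down steadyS steadyT ¬jump (zero , zero , () , _)
plus-down {D₁ = D₁} {D₂} steadyS steadyT ¬jump (zero , suc j , refl , s , t) =
  step-down steadyT t >>= λ where
    (inj₁ t') → pure (zero , j , refl , s , t')
    (inj₂ jumpⱼ) → ⊥-elim (¬jump (jump-mono (m≤n+m D₂ D₁) jumpⱼ))
plus-down {D₁ = D₁} {D₂} {S} {T} steadyS steadyT ¬jump (suc i , j , refl , s , t) =
  step-down steadyS s >>= λ where
    (inj₁ s') → pure (i , j , refl , s' , t)
    (inj₂ jumpᵢ) → blocked j ¬jump t jumpᵢ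
  where
  blocked : ∀ j → ¬ JumpAt _ (D₁ + D₂) (i + j) → T j → JumpAt _ D₁ i → ¬ ¬ (S ⊕ T) (i + j)
  blocked zero ¬jump _ jumpᵢ =
    ⊥-elim (¬jump (subst (JumpAt _ _) (sym (+-identityʳ i)) (jump-mono (m≤m+n D₁ D₂) jumpᵢ)))
  blocked (suc j) ¬jump t jumpᵢ = step-down steadyT t >>= λ where
    (inj₁ t') → pure (suc i , j , sym (+-suc i j) , s , t')
    (inj₂ jumpⱼ) → ⊥-elim (¬jump (jump-+ jumpᵢ jumpⱼ (+-monoʳ-≤ i (n≤1+n j)) (≤-reflexive (+-suc i j))))

plus-steady : ∀ {n D₁ D₂ S T} → Steady n D₁ S → Steady n D₂ T → Steady n (D₁ + D₂) (S ⊕ T)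
plus-steady steadyS steadyT k ¬jump = plus-up steadyS steadyT ¬jump , plus-down steadyS steadyT ¬jump

inP-bounded : ∀ {S} → (S ≈ ∅) ⊎ (S ≈ ⟨ 0 ⟩) → ∀ k → S k → k ≤ 0
inP-bounded (inj₁ S≈∅) k s = ⊥-elim (proj₁ (S≈∅ k) s)
inP-bounded (inj₂ S≈⟨0⟩) k s = ≤-reflexive (proj₁ (S≈⟨0⟩ k) s)

circuit-steady : ∀ {k} (D₀ : ℕ) (C : Circ k) → Σ ℕ λ D →
                 ∀ n (ρ : Fin k → SetN) → (∀ i → Steady n D₀ (ρ i)) → Steady n D (⟦ C ⟧ ρ)
circuit-steady D₀ (var i) = D₀ , λ n ρ steady → steady i
circuit-steady D₀ cempty = 1 , λ n ρ _ → bounded-steady 0 (λ k ())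
circuit-steady D₀ cfull = 0 , λ n ρ _ → full-steady
circuit-steady D₀ (csing c) = suc c , λ n ρ _ → bounded-steady c (λ k → ≤-reflexive)
circuit-steady D₀ (cunion C C') with circuit-steady D₀ C | circuit-steady D₀ C'
... | D₁ , steady₁ | D₂ , steady₂ = D₁ + D₂ , λ n ρ steady →
  union-steady (steady-mono (m≤m+n D₁ D₂) (steady₁ n ρ steady))
               (steady-mono (m≤n+m D₂ D₁) (steady₂ n ρ steady))
circuit-steady D₀ (cinter C C') with circuit-steady D₀ C | circuit-steady D₀ C'
... | D₁ , steady₁ | D₂ , steady₂ = D₁ + D₂ , λ n ρ steady →
  inter-steady (steady-mono (m≤m+n D₁ D₂) (steady₁ n ρ steady))
               (steady-mono (m≤n+m D₂ D₁) (steady₂ n ρ steady))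
circuit-steady D₀ (ccompl C) with circuit-steady D₀ C
... | D , steady₁ = D , λ n ρ steady → compl-steady (steady₁ n ρ steady)
circuit-steady D₀ (cplus C C') with circuit-steady D₀ C | circuit-steady D₀ C'
... | D₁ , steady₁ | D₂ , steady₂ = D₁ + D₂ , λ n ρ steady →
  plus-steady (steady₁ n ρ steady) (steady₂ n ρ steady)
circuit-steady D₀ (cdown C) with circuit-steady D₀ C
... | D , steady₁ = D , λ n ρ steady → down-steady (steady₁ n ρ steady)
circuit-steady D₀ (cP m f (_ , values) Cs) =
  1 , λ n ρ _ → bounded-steady 0 (inP-bounded (values (λ i → ⟦ Cs i ⟧ ρ)))

interval : ℕ → SetN
interval n k = k ≤ n

-- [0, n] changes only between n and n + 1, and n is a jump point of width 1.
interval-steady : ∀ n → Steady n 1 (interval n)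
interval-steady n k ¬jump = up , (λ k+1≤n ¬k≤n → ¬k≤n (≤-trans (n≤1+n k) k+1≤n))
  where
  n-jump : JumpAt n 1 n
  n-jump = 1 , ≤-reflexive (*-identityˡ n) ,
           ≤-reflexive (trans (sym (+-comm n 1)) (cong (_+ 1) (sym (*-identityˡ n))))
  up : k ≤ n → ¬ ¬ (suc k ≤ n)
  up k≤n with m≤n⇒m<n∨m≡n k≤n
  ... | inj₁ k<n = pure k<n
  ... | inj₂ refl = ⊥-elim (¬jump n-jump)

max-interval : ∀ n → Max (interval n) n
max-interval n = inj₂ (≤-refl , λ m m≤n → m≤n)

not-max-interval : ∀ {n m} → m < n → ¬ Max (interval n) m
not-max-interval {n} _ (inj₁ infinite) with infinite (suc n)
... | m , n<m , m≤n = <⇒≱ n<m m≤n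
not-max-interval {n} m<n (inj₂ (_ , maximal)) = <⇒≱ m<n (maximal n ≤-refl)

-- A circuit computing Max would make Max [0, D + 1] steady of width D, yet it
-- contains D + 1 and not D although D is not a jump point.
corollary5 : ¬ Definable MaxFun
corollary5 (C , computes) with circuit-steady 1 C
... | D , steady = proj₂ (max-steady D (no-jump D)) (max-interval n) (not-max-interval ≤-refl)
  where
  n : ℕ
  n = suc D
  max-steady : Steady n D (Max (interval n))
  max-steady = steady-resp (computes (λ _ → interval n))
                 (steady n (λ _ → interval n) (λ _ → interval-steady n))
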